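{- Let $q\ge 2$, $b\ge 1$, $c\ge 1$ be integers. Then either there is no $(b,c)$-coloring of $H(n,q)$ for any positive integer $n$, or there is a positive integer $n_0=n_0(b,c;q)$ such that a $(b,c)$-coloring of $H(n,q)$ exists if and only if $n\ge n_0$.
   Context: $H(n,q)$: vertex set $\mathbb{Z}_q^n$, two vertices adjacent iff they differ in exactly one coordinate. A $(b,c)$-coloring of $H(n,q)$ is a surjective map from the vertices onto $\{1,2\}$ such that every vertex of color $1$ has exactly $b$ neighbors of color $2$ and every vertex of color $2$ has exactly $c$ neighbors of color $1$. -}

module Defs where

open import Data.Nat using (ℕ; suc; _+_)
open import Data.Fin using (Fin; zero; suc; _≟_)
open import Data.Vec using (Vec; lookup; _[_]≔_)
open import Data.List using (List; sum; map; allFin; length; filter)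
open import Data.Product using (Σ; _×_; ∃)
open import Relation.Binary.PropositionalEquality using (_≡_)
open import Relation.Nullary using (¬_)
open import Relation.Nullary.Decidable using (Dec)

Vertex : ℕ → ℕ → Set
Vertex n q = Vec (Fin q) n

-- The two colors 1 and 2 are represented by Fin 2 (zero = color 1, suc zero = color 2).
Color : Set
Color = Fin 2

neighbours : ∀ {n q} → Vertex n q → List (Vertex n q)
neighbours {n} {q} x =
  Data.List.concatMap
    (λ i → map (λ a → x [ i ]≔ a)
               (filter (λ a → Relation.Nullary.¬? (a ≟ lookup x i)) (allFin q)))
    (allFin n)

nbrsOfColor : ∀ {n q} → (Vertex n q → Color) → Color → Vertex n q → ℕ
nbrsOfColor f k x = length (filter (λ y → f y ≟ k) (neighbours x))

Surjective : ∀ {n q} → (Vertex n q → Color) → Set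
Surjective {n} {q} f = ∀ (k : Color) → ∃ λ (x : Vertex n q) → f x ≡ k

IsBCColoring : (n q b c : ℕ) → (Vertex n q → Color) → Set
IsBCColoring n q b c f =
  Surjective f
  × (∀ x → f x ≡ zero → nbrsOfColor f (suc zero) x ≡ b)
  × (∀ x → f x ≡ suc zero → nbrsOfColor f zero x ≡ c)

HasBCColoring : (n q b c : ℕ) → Set
HasBCColoring n q b c = Σ (Vertex n q → Color) (IsBCColoring n q b c)

-- Colourability is inherited upwards (ignore a new coordinate) and decidable for each n
-- (exhaustive search), so by a bounded search for the least colourable dimension
-- (`threshold`) it suffices to show: if H(n,q) is colourable, so is some H(m,q) with
-- m ≤ q(b+c)q^(b+c) (`colourable-within`).  Coordinates a colouring ignores can be
-- dropped.  If a colouring depends on every coordinate, weight it by b on colour 1 and -c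
-- on colour 2; this is an eigenfunction of the adjacency operator A, and the difference of
-- two parallel slices is a nonzero eigenfunction of H(n-1,q).  A support bound for
-- eigenfunctions (`support-bound`: if h ≠ 0 and A h = (m(q-1) - qj) h then h is nonzero on
-- at least q^(m-j) vertices) gives at least q^(n-1-(b+c)) bichromatic edge-ends in every
-- direction, while there are at most q^n(b+c) in total; this bounds n.
module Submission where

open import Defs
open import Data.Nat using (ℕ; zero; suc; _+_; _*_; _∸_; _^_; _≤_; _<_; _≥_; z≤n; s≤s; NonZero)
import Data.Nat.Properties as ℕP
import Data.Nat.Tactic.RingSolver as ℕSolver
open import Data.Nat.ListAction using (sum)
open import Data.Nat.ListAction.Properties using (sum-↭)
open import Data.Integer as ℤ using (ℤ; +_; 0ℤ; 1ℤ)
  renaming (_+_ to _+ᶻ_; _*_ to _*ᶻ_; _-_ to _-ᶻ_)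
import Data.Integer.Properties as ℤP
open import Data.Integer.Tactic.RingSolver using (solve-∀)
open import Data.Fin using (Fin; zero; suc; _≟_)
open import Data.Fin.Properties using (any?; all?)
open import Data.Vec using ([]; _∷_; head; tail; lookup; removeAt; insertAt; _[_]≔_)
open import Data.Vec.Properties using (insertAt-lookup; insertAt-removeAt)
open import Data.List using (List; []; _∷_; _++_; map; allFin; tabulate; filter; concat; concatMap; length; foldr)
open import Data.List.Properties
  using (map-++; map-∘; map-cong; map-tabulate; tabulate-cong; map-concatMap; length-map; length-++;
         length-tabulate; filter-++; filter-some)
open import Data.List.Membership.Propositional using (_∈_)
open import Data.List.Membership.Propositional.Properties using (∈-map⁺; ∈-filter⁺; ∈-allFin)
import Data.List.Relation.Unary.Any as Any
open import Data.List.Relation.Unary.Any using (here; there)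
open import Data.List.Relation.Binary.Permutation.Propositional
  using (_↭_; ↭-reflexive; ↭⇒↭ₛ; module PermutationReasoning)
open import Data.List.Relation.Binary.Permutation.Propositional.Properties
  using (map⁺; ++⁺ˡ; shifts; ↭-length; filter-↭)
open import Data.List.Relation.Binary.Permutation.Setoid.Properties using (foldr-commMonoid)
open import Algebra.Bundles using (CommutativeMonoid)
open import Algebra.Properties.CommutativeSemigroup ℕP.+-commutativeSemigroup
  using () renaming (interchange to +-interchange)
open import Algebra.Properties.CommutativeSemigroup ℕP.*-commutativeSemigroup
  using () renaming (x∙yz≈y∙xz to *-exchange)
open import Data.Product using (Σ; ∃; _×_; _,_; proj₁; proj₂)
open import Data.Sum using (_⊎_; inj₁; inj₂)
open import Data.Empty using (⊥-elim)
open import Relation.Binary.PropositionalEquality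
open import Relation.Nullary using (¬_; ¬?; yes; no; Dec)
open import Relation.Nullary.Decidable using (_×-dec_; _→-dec_)
open import Function using (_∘_; id)
open import Function.Bundles using (_⇔_; mk⇔)

differs : ∀ {q} (a a′ : Fin q) → Dec (a′ ≢ a)
differs a a′ = ¬? (a′ ≟ a)

others : ∀ {q} → Fin q → List (Fin q)
others {q} a = filter (differs a) (allFin q)

allFin-suc : ∀ q → allFin (suc q) ≡ zero ∷ map suc (allFin q)
allFin-suc q = cong (zero ∷_) (sym (map-tabulate id suc))

others-zero : ∀ q → others {suc q} zero ≡ map suc (allFin q)
others-zero q = trans (cong (filter (differs zero)) (allFin-suc q)) (keep (allFin q))
  where
  keep : (l : List (Fin q)) → filter (differs zero) (map suc l) ≡ map suc l
  keep []      = refl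
  keep (x ∷ l) = cong (suc x ∷_) (keep l)

others-suc : ∀ {q} (a : Fin q) → others (suc a) ≡ zero ∷ map suc (others a)
others-suc {q} a = trans (cong (filter (differs (suc a))) (allFin-suc q)) (cong (zero ∷_) (commute (allFin q)))
  where
  commute : (l : List (Fin q)) →
    filter (differs (suc a)) (map suc l) ≡ map suc (filter (differs a) l)
  commute [] = refl
  commute (x ∷ l) with x ≟ a
  ... | yes _ = commute l
  ... | no _  = cong (suc x ∷_) (commute l)

allFin-↭ : ∀ {q} (a : Fin q) → allFin q ↭ a ∷ others a
allFin-↭ {suc q} zero = ↭-reflexive (trans (allFin-suc q) (cong (zero ∷_) (sym (others-zero q))))
allFin-↭ {suc q} (suc a) = begin
  allFin (suc q)                       ≡⟨ allFin-suc q ⟩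
  zero ∷ map suc (allFin q)            <⟨ map⁺ suc (allFin-↭ a) ⟩
  zero ∷ suc a ∷ map suc (others a)    <<⟨ ↭-reflexive refl ⟩
  suc a ∷ zero ∷ map suc (others a)    ≡⟨ cong (suc a ∷_) (sym (others-suc a)) ⟩
  suc a ∷ others (suc a)               ∎
  where open PermutationReasoning

length-others : ∀ {q} (a : Fin q) → length (others a) ≡ q ∸ 1
length-others {q} a = cong (_∸ 1) (trans (sym (↭-length (allFin-↭ a))) (length-tabulate {n = q} id))

neighboursAlong : ∀ {m q} → Vertex m q → Fin m → List (Vertex m q)
neighboursAlong {q = q} y i = map (y [ i ]≔_) (filter (differs (lookup y i)) (allFin q))

neighbours-cons : ∀ {n q} (a : Fin q) (x : Vertex n q) →
  neighbours (a ∷ x) ≡ map (_∷ x) (others a) ++ map (a ∷_) (neighbours x)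
neighbours-cons {n} {q} a x = cong (map (_∷ x) (others a) ++_) (begin
  concat (map (neighboursAlong (a ∷ x)) (tabulate suc))  ≡⟨ cong concat (map-tabulate suc (neighboursAlong (a ∷ x))) ⟩
  concat (tabulate (neighboursAlong (a ∷ x) ∘ suc))      ≡⟨ cong concat (tabulate-cong alongTail) ⟩
  concat (tabulate (map (a ∷_) ∘ neighboursAlong x))     ≡⟨ cong concat (map-tabulate id (map (a ∷_) ∘ neighboursAlong x)) ⟨
  concatMap (map (a ∷_) ∘ neighboursAlong x) (allFin n)  ≡⟨ map-concatMap (a ∷_) (neighboursAlong x) (allFin n) ⟨
  map (a ∷_) (neighbours x)                              ∎)
  where
  open ≡-Reasoning
  alongTail : ∀ i → neighboursAlong (a ∷ x) (suc i) ≡ map (a ∷_) (neighboursAlong x i)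
  alongTail i = map-∘ (filter (differs (lookup x i)) (allFin q))

neighbours-insertAt : ∀ {n q} (y : Vertex n q) (i : Fin (suc n)) (a : Fin q) →
  neighbours (insertAt y i a)
    ↭ map (insertAt y i) (others a) ++ map (λ z → insertAt z i a) (neighbours y)
neighbours-insertAt y zero a = ↭-reflexive (neighbours-cons a y)
neighbours-insertAt {suc n} (b ∷ y) (suc i) a = begin
  neighbours (b ∷ insertAt y i a)
    ≡⟨ neighbours-cons b (insertAt y i a) ⟩
  headMoves ++ map (b ∷_) (neighbours (insertAt y i a))
    ↭⟨ ++⁺ˡ headMoves (map⁺ (b ∷_) (neighbours-insertAt y i a)) ⟩
  headMoves ++ map (b ∷_) (map (insertAt y i) (others a) ++ map (λ z → insertAt z i a) (neighbours y))
    ≡⟨ cong (headMoves ++_) (map-++ (b ∷_) (map (insertAt y i) (others a)) _) ⟩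
  headMoves ++ map (b ∷_) (map (insertAt y i) (others a)) ++ map (b ∷_) (map (λ z → insertAt z i a) (neighbours y))
    ↭⟨ shifts headMoves (map (b ∷_) (map (insertAt y i) (others a))) ⟩
  map (b ∷_) (map (insertAt y i) (others a)) ++ headMoves ++ map (b ∷_) (map (λ z → insertAt z i a) (neighbours y))
    ≡⟨ cong₂ _++_ (sym (map-∘ (others a))) (cong (headMoves ++_) (trans (sym (map-∘ (neighbours y))) (map-∘ (neighbours y)))) ⟩
  map (insertAt (b ∷ y) (suc i)) (others a) ++ headMoves ++ map (λ z → insertAt z (suc i) a) (map (b ∷_) (neighbours y))
    ≡⟨ cong (map (insertAt (b ∷ y) (suc i)) (others a) ++_) tailMoves ⟩
  map (insertAt (b ∷ y) (suc i)) (others a) ++ map (λ z → insertAt z (suc i) a) (neighbours (b ∷ y)) ∎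
  where
  open PermutationReasoning
  headMoves : List (Vertex (suc (suc n)) _)
  headMoves = map (_∷ insertAt y i a) (others b)
  tailMoves : headMoves ++ map (λ z → insertAt z (suc i) a) (map (b ∷_) (neighbours y))
            ≡ map (λ z → insertAt z (suc i) a) (neighbours (b ∷ y))
  tailMoves = sym (trans (cong (map (λ z → insertAt z (suc i) a)) (neighbours-cons b y))
    (trans (map-++ (λ z → insertAt z (suc i) a) (map (_∷ y) (others b)) _)
           (cong (_++ map (λ z → insertAt z (suc i) a) (map (b ∷_) (neighbours y))) (sym (map-∘ (others b))))))

insertAt-update : ∀ {n q} (y : Vertex n q) (i : Fin (suc n)) (a a′ : Fin q) →
  insertAt y i a [ i ]≔ a′ ≡ insertAt y i a′
insertAt-update y       zero    a a′ = refl
insertAt-update (b ∷ y) (suc i) a a′ = cong (b ∷_) (insertAt-update y i a a′)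

insertAt-∈-neighboursAlong : ∀ {n q} (y : Vertex n q) (i : Fin (suc n)) {a a′ : Fin q} → a′ ≢ a →
  insertAt y i a′ ∈ neighboursAlong (insertAt y i a) i
insertAt-∈-neighboursAlong y i {a} {a′} a′≢a = subst (_∈ neighboursAlong (insertAt y i a) i) (insertAt-update y i a a′)
  (∈-map⁺ (insertAt y i a [ i ]≔_) (∈-filter⁺ (differs (lookup (insertAt y i a) i)) (∈-allFin a′)
    (λ a′≡ → a′≢a (trans a′≡ (insertAt-lookup y i a)))))

length-neighbours : ∀ {n q} (x : Vertex n q) → length (neighbours x) ≡ n * (q ∸ 1)
length-neighbours []      = refl
length-neighbours {suc n} {q} (a ∷ x) = begin
  length (neighbours (a ∷ x))                                           ≡⟨ cong length (neighbours-cons a x) ⟩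
  length (map (_∷ x) (others a) ++ map (a ∷_) (neighbours x))           ≡⟨ length-++ (map (_∷ x) (others a)) ⟩
  length (map (_∷ x) (others a)) + length (map (a ∷_) (neighbours x))   ≡⟨ cong₂ _+_ (length-map (_∷ x) (others a)) (length-map (a ∷_) (neighbours x)) ⟩
  length (others a) + length (neighbours x)                             ≡⟨ cong₂ _+_ (length-others a) (length-neighbours x) ⟩
  q ∸ 1 + n * (q ∸ 1)                                                   ∎
  where open ≡-Reasoning

sumℤ : List ℤ → ℤ
sumℤ = foldr _+ᶻ_ 0ℤ

sumℤ-++ : ∀ xs ys → sumℤ (xs ++ ys) ≡ sumℤ xs +ᶻ sumℤ ys
sumℤ-++ []       ys = sym (ℤP.+-identityˡ (sumℤ ys))
sumℤ-++ (x ∷ xs) ys = trans (cong (x +ᶻ_) (sumℤ-++ xs ys)) (sym (ℤP.+-assoc x (sumℤ xs) (sumℤ ys)))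

sumℤ-↭ : ∀ {xs ys} → xs ↭ ys → sumℤ xs ≡ sumℤ ys
sumℤ-↭ p = foldr-commMonoid ℤ+.setoid ℤ+.isCommutativeMonoid (↭⇒↭ₛ p)
  where module ℤ+ = CommutativeMonoid ℤP.+-0-commutativeMonoid

sumℤ-const : ∀ {X : Set} (z : ℤ) (l : List X) → sumℤ (map (λ _ → z) l) ≡ + length l *ᶻ z
sumℤ-const z []      = sym (ℤP.*-zeroˡ z)
sumℤ-const z (_ ∷ l) = trans (cong (z +ᶻ_) (sumℤ-const z l)) (sym (ℤP.suc-* (+ length l) z))

sumℤ-difference : ∀ {X : Set} (f g : X → ℤ) (l : List X) →
  sumℤ (map (λ x → f x -ᶻ g x) l) ≡ sumℤ (map f l) -ᶻ sumℤ (map g l)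
sumℤ-difference f g []      = refl
sumℤ-difference f g (x ∷ l) =
  trans (cong ((f x -ᶻ g x) +ᶻ_) (sumℤ-difference f g l)) (interchange (f x) (g x) _ _)
  where
  interchange : ∀ a b c d → (a -ᶻ b) +ᶻ (c -ᶻ d) ≡ (a +ᶻ c) -ᶻ (b +ᶻ d)
  interchange = solve-∀

A : ∀ {n q} → (Vertex n q → ℤ) → Vertex n q → ℤ
A h x = sumℤ (map h (neighbours x))

A-difference : ∀ {n q} (f g : Vertex n q → ℤ) x → A (λ y → f y -ᶻ g y) x ≡ A f x -ᶻ A g x
A-difference f g x = sumℤ-difference f g (neighbours x)

A-insertAt : ∀ {n q} (h : Vertex (suc n) q → ℤ) (y : Vertex n q) (i : Fin (suc n)) (a : Fin q) →
  A h (insertAt y i a) ≡ sumℤ (map (h ∘ insertAt y i) (others a)) +ᶻ A (λ z → h (insertAt z i a)) y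
A-insertAt h y i a = begin
  sumℤ (map h (neighbours (insertAt y i a)))
    ≡⟨ sumℤ-↭ (map⁺ h (neighbours-insertAt y i a)) ⟩
  sumℤ (map h (map (insertAt y i) (others a) ++ map (λ z → insertAt z i a) (neighbours y)))
    ≡⟨ cong sumℤ (map-++ h (map (insertAt y i) (others a)) _) ⟩
  sumℤ (map h (map (insertAt y i) (others a)) ++ map h (map (λ z → insertAt z i a) (neighbours y)))
    ≡⟨ sumℤ-++ (map h (map (insertAt y i) (others a))) _ ⟩
  sumℤ (map h (map (insertAt y i) (others a))) +ᶻ sumℤ (map h (map (λ z → insertAt z i a) (neighbours y)))
    ≡⟨ cong₂ _+ᶻ_ (cong sumℤ (sym (map-∘ (others a)))) (cong sumℤ (sym (map-∘ (neighbours y)))) ⟩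
  sumℤ (map (h ∘ insertAt y i) (others a)) +ᶻ A (λ z → h (insertAt z i a)) y ∎
  where open ≡-Reasoning

sumℤ-allFin : ∀ {q} (g : Fin q → ℤ) (a : Fin q) → sumℤ (map g (allFin q)) ≡ g a +ᶻ sumℤ (map g (others a))
sumℤ-allFin g a = sumℤ-↭ (map⁺ g (allFin-↭ a))

degree : ℕ → ℕ → ℤ
degree q m = + (m * (q ∸ 1))

degree-suc : ∀ {q} → Fin q → ∀ m → degree q (suc m) ≡ (+ q -ᶻ 1ℤ) +ᶻ degree q m
degree-suc {suc q} _ m = ℤP.pos-+ q (m * q)

-- h satisfies A h = (m(q-1) - t) h: it is zero or an eigenfunction of H(m,q)
-- with eigenvalue m(q-1) - t.
IsEigen : ∀ {q} m → ℤ → (Vertex m q → ℤ) → Set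
IsEigen {q} m t h = ∀ x → A h x +ᶻ t *ᶻ h x ≡ degree q m *ᶻ h x

slice : ∀ {m q} → (Vertex (suc m) q → ℤ) → Fin (suc m) → Fin q → Vertex m q → ℤ
slice h i a z = h (insertAt z i a)

lineSum : ∀ {m q} → (Vertex (suc m) q → ℤ) → Fin (suc m) → Vertex m q → ℤ
lineSum {q = q} h i y = sumℤ (map (h ∘ insertAt y i) (allFin q))

-- The eigen-equation of h, read on a slice: the slice satisfies the eigen-equation
-- of H(m,q) with t lowered by q, up to the line sum, which is the same for all slices.
slice-equation : ∀ {m q} t (h : Vertex (suc m) q → ℤ) → IsEigen (suc m) t h →
  ∀ i a y → A (slice h i a) y +ᶻ (t -ᶻ + q) *ᶻ slice h i a y +ᶻ lineSum h i y ≡ degree q m *ᶻ slice h i a y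
slice-equation {m} {q} t h eig i a y = begin
  Aₐ +ᶻ (t -ᶻ + q) *ᶻ hₐ +ᶻ lineSum h i y
    ≡⟨ cong (Aₐ +ᶻ (t -ᶻ + q) *ᶻ hₐ +ᶻ_) (sumℤ-allFin (h ∘ insertAt y i) a) ⟩
  Aₐ +ᶻ (t -ᶻ + q) *ᶻ hₐ +ᶻ (hₐ +ᶻ line)
    ≡⟨ regroup Aₐ hₐ line t (+ q) ⟩
  ((line +ᶻ Aₐ) +ᶻ t *ᶻ hₐ) -ᶻ (+ q -ᶻ 1ℤ) *ᶻ hₐ
    ≡⟨ cong (λ e → (e +ᶻ t *ᶻ hₐ) -ᶻ (+ q -ᶻ 1ℤ) *ᶻ hₐ) (sym (A-insertAt h y i a)) ⟩
  (A h (insertAt y i a) +ᶻ t *ᶻ hₐ) -ᶻ (+ q -ᶻ 1ℤ) *ᶻ hₐ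
    ≡⟨ cong (_-ᶻ (+ q -ᶻ 1ℤ) *ᶻ hₐ) (eig (insertAt y i a)) ⟩
  degree q (suc m) *ᶻ hₐ -ᶻ (+ q -ᶻ 1ℤ) *ᶻ hₐ
    ≡⟨ cong (λ d → d *ᶻ hₐ -ᶻ (+ q -ᶻ 1ℤ) *ᶻ hₐ) (degree-suc a m) ⟩
  ((+ q -ᶻ 1ℤ) +ᶻ degree q m) *ᶻ hₐ -ᶻ (+ q -ᶻ 1ℤ) *ᶻ hₐ
    ≡⟨ cancel (+ q -ᶻ 1ℤ) (degree q m) hₐ ⟩
  degree q m *ᶻ hₐ ∎
  where
  open ≡-Reasoning
  Aₐ hₐ line : ℤ
  Aₐ = A (slice h i a) y
  hₐ = slice h i a y
  line = sumℤ (map (h ∘ insertAt y i) (others a))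
  regroup : ∀ α η λ′ t q → α +ᶻ (t -ᶻ q) *ᶻ η +ᶻ (η +ᶻ λ′) ≡ ((λ′ +ᶻ α) +ᶻ t *ᶻ η) -ᶻ (q -ᶻ 1ℤ) *ᶻ η
  regroup = solve-∀
  cancel : ∀ p d η → (p +ᶻ d) *ᶻ η -ᶻ p *ᶻ η ≡ d *ᶻ η
  cancel = solve-∀

-- The difference of two parallel slices of an eigenfunction is an eigenfunction
-- of H(m,q) with t lowered by q (the line sums cancel).
difference-eigen : ∀ {m q} t (h : Vertex (suc m) q → ℤ) → IsEigen (suc m) t h →
  ∀ i a₁ a₀ → IsEigen m (t -ᶻ + q) (λ y → slice h i a₁ y -ᶻ slice h i a₀ y)
difference-eigen {m} {q} t h eig i a₁ a₀ y = begin
  A d y +ᶻ s *ᶻ (h₁ -ᶻ h₀)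
    ≡⟨ cong (_+ᶻ s *ᶻ (h₁ -ᶻ h₀)) (A-difference (slice h i a₁) (slice h i a₀) y) ⟩
  (A₁ -ᶻ A₀) +ᶻ s *ᶻ (h₁ -ᶻ h₀)
    ≡⟨ subtract A₁ A₀ h₁ h₀ s (lineSum h i y) ⟩
  (A₁ +ᶻ s *ᶻ h₁ +ᶻ lineSum h i y) -ᶻ (A₀ +ᶻ s *ᶻ h₀ +ᶻ lineSum h i y)
    ≡⟨ cong₂ _-ᶻ_ (slice-equation t h eig i a₁ y) (slice-equation t h eig i a₀ y) ⟩
  degree q m *ᶻ h₁ -ᶻ degree q m *ᶻ h₀
    ≡⟨ factor (degree q m) h₁ h₀ ⟩
  degree q m *ᶻ (h₁ -ᶻ h₀) ∎
  where
  open ≡-Reasoning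
  d : Vertex m q → ℤ
  d z = slice h i a₁ z -ᶻ slice h i a₀ z
  s A₁ A₀ h₁ h₀ : ℤ
  s = t -ᶻ + q
  A₁ = A (slice h i a₁) y
  A₀ = A (slice h i a₀) y
  h₁ = slice h i a₁ y
  h₀ = slice h i a₀ y
  subtract : ∀ α₁ α₀ η₁ η₀ s l → (α₁ -ᶻ α₀) +ᶻ s *ᶻ (η₁ -ᶻ η₀) ≡ (α₁ +ᶻ s *ᶻ η₁ +ᶻ l) -ᶻ (α₀ +ᶻ s *ᶻ η₀ +ᶻ l)
  subtract = solve-∀
  factor : ∀ δ η₁ η₀ → δ *ᶻ η₁ -ᶻ δ *ᶻ η₀ ≡ δ *ᶻ (η₁ -ᶻ η₀)
  factor = solve-∀

-- A slice of an eigenfunction that does not depend on coordinate i is an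
-- eigenfunction of H(m,q) with the same t (its line sums are q times its value).
constant-slice-eigen : ∀ {m q} t (h : Vertex (suc m) q → ℤ) → IsEigen (suc m) t h →
  ∀ i a → (∀ y a′ → slice h i a′ y ≡ slice h i a y) → IsEigen m t (slice h i a)
constant-slice-eigen {m} {q} t h eig i a constant y = begin
  A (slice h i a) y +ᶻ t *ᶻ hₐ
    ≡⟨ regroup (A (slice h i a) y) hₐ t (+ q) ⟩
  A (slice h i a) y +ᶻ (t -ᶻ + q) *ᶻ hₐ +ᶻ + q *ᶻ hₐ
    ≡⟨ cong (A (slice h i a) y +ᶻ (t -ᶻ + q) *ᶻ hₐ +ᶻ_) (sym lineSum≡) ⟩
  A (slice h i a) y +ᶻ (t -ᶻ + q) *ᶻ hₐ +ᶻ lineSum h i y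
    ≡⟨ slice-equation t h eig i a y ⟩
  degree q m *ᶻ hₐ ∎
  where
  open ≡-Reasoning
  hₐ : ℤ
  hₐ = slice h i a y
  lineSum≡ : lineSum h i y ≡ + q *ᶻ hₐ
  lineSum≡ = trans (cong sumℤ (map-cong (constant y) (allFin q)))
    (trans (sumℤ-const hₐ (allFin q)) (cong (λ k → + k *ᶻ hₐ) (length-tabulate {n = q} id)))
  regroup : ∀ α η t q → α +ᶻ t *ᶻ η ≡ α +ᶻ (t -ᶻ q) *ᶻ η +ᶻ q *ᶻ η
  regroup = solve-∀

sum-map-mono : ∀ {X : Set} {f g : X → ℕ} → (∀ x → f x ≤ g x) → ∀ l → sum (map f l) ≤ sum (map g l)
sum-map-mono f≤g []      = z≤n
sum-map-mono f≤g (x ∷ l) = ℕP.+-mono-≤ (f≤g x) (sum-map-mono f≤g l)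

sum-map-+ : ∀ {X : Set} (f g : X → ℕ) l → sum (map (λ x → f x + g x) l) ≡ sum (map f l) + sum (map g l)
sum-map-+ f g []      = refl
sum-map-+ f g (x ∷ l) = trans (cong (_+_ (f x + g x)) (sum-map-+ f g l)) (+-interchange (f x) (g x) _ _)

sum-map-const : ∀ {X : Set} (c : ℕ) (l : List X) → sum (map (λ _ → c) l) ≡ length l * c
sum-map-const c []      = refl
sum-map-const c (_ ∷ l) = cong (_+_ c) (sum-map-const c l)

sum-map-*ʳ : ∀ {X : Set} (f : X → ℕ) (r : ℕ) l → sum (map (λ x → f x * r) l) ≡ sum (map f l) * r
sum-map-*ʳ f r []      = refl
sum-map-*ʳ f r (x ∷ l) = trans (cong (_+_ (f x * r)) (sum-map-*ʳ f r l)) (sym (ℕP.*-distribʳ-+ r (f x) _))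

sum-allFin-≥ : ∀ {q} (g : Fin q → ℕ) (a : Fin q) → g a ≤ sum (map g (allFin q))
sum-allFin-≥ g a = ℕP.≤-trans (ℕP.m≤m+n (g a) _) (ℕP.≤-reflexive (sym (sum-↭ (map⁺ g (allFin-↭ a)))))

sum-allFin-pair : ∀ {q} (g : Fin q → ℕ) {a₀ a₁ : Fin q} → a₁ ≢ a₀ → g a₀ + g a₁ ≤ sum (map g (allFin q))
sum-allFin-pair g {a₀} {a₁} a₁≢a₀ = begin
  g a₀ + g a₁                        ≤⟨ ℕP.+-monoʳ-≤ (g a₀) (member (∈-filter⁺ (differs a₀) (∈-allFin a₁) a₁≢a₀)) ⟩
  g a₀ + sum (map g (others a₀))     ≡⟨ sum-↭ (map⁺ g (allFin-↭ a₀)) ⟨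
  sum (map g (allFin _))             ∎
  where
  open ℕP.≤-Reasoning
  member : ∀ {a l} → a ∈ l → g a ≤ sum (map g l)
  member (here refl)       = ℕP.m≤m+n _ _
  member {l = b ∷ _} (there a∈l) = ℕP.≤-trans (member a∈l) (ℕP.m≤n+m _ (g b))

vsum : ∀ {m q} → (Vertex m q → ℕ) → ℕ
vsum {zero}      F = F []
vsum {suc m} {q} F = sum (map (λ a → vsum (λ y → F (a ∷ y))) (allFin q))

vsum-cong : ∀ {m q} {F G : Vertex m q → ℕ} → (∀ x → F x ≡ G x) → vsum F ≡ vsum G
vsum-cong {zero}      F≡G = F≡G []
vsum-cong {suc m} {q} F≡G = cong sum (map-cong (λ a → vsum-cong (λ y → F≡G (a ∷ y))) (allFin q))

vsum-mono : ∀ {m q} {F G : Vertex m q → ℕ} → (∀ x → F x ≤ G x) → vsum F ≤ vsum G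
vsum-mono {zero}      F≤G = F≤G []
vsum-mono {suc m} {q} F≤G = sum-map-mono (λ a → vsum-mono (λ y → F≤G (a ∷ y))) (allFin q)

vsum-+ : ∀ {m q} (F G : Vertex m q → ℕ) → vsum (λ x → F x + G x) ≡ vsum F + vsum G
vsum-+ {zero}      F G = refl
vsum-+ {suc m} {q} F G =
  trans (cong sum (map-cong (λ a → vsum-+ (λ y → F (a ∷ y)) (λ y → G (a ∷ y))) (allFin q)))
        (sum-map-+ (λ a → vsum (λ y → F (a ∷ y))) (λ a → vsum (λ y → G (a ∷ y))) (allFin q))

vsum-const : ∀ {m q} (c : ℕ) → vsum {m} {q} (λ _ → c) ≡ q ^ m * c
vsum-const {zero}      c = sym (ℕP.+-identityʳ c)
vsum-const {suc m} {q} c = begin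
  sum (map (λ _ → vsum {m} {q} (λ _ → c)) (allFin q)) ≡⟨ cong sum (map-cong (λ _ → vsum-const {m} c) (allFin q)) ⟩
  sum (map (λ _ → q ^ m * c) (allFin q))              ≡⟨ sum-map-const (q ^ m * c) (allFin q) ⟩
  length (allFin q) * (q ^ m * c)                      ≡⟨ cong (_* (q ^ m * c)) (length-tabulate {n = q} id) ⟩
  q * (q ^ m * c)                                      ≡⟨ ℕP.*-assoc q (q ^ m) c ⟨
  q ^ suc m * c                                        ∎
  where open ≡-Reasoning

vsum-sum : ∀ {m q} {X : Set} (G : X → Vertex m q → ℕ) (l : List X) →
  vsum (λ x → sum (map (λ a → G a x) l)) ≡ sum (map (λ a → vsum (G a)) l)
vsum-sum {m} G []      = trans (vsum-const {m} 0) (ℕP.*-zeroʳ (_ ^ m))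
vsum-sum     G (a ∷ l) = trans (vsum-+ (G a) (λ x → sum (map (λ b → G b x) l))) (cong (_+_ (vsum (G a))) (vsum-sum G l))

vsum-lines : ∀ {m q} (F : Vertex (suc m) q → ℕ) (i : Fin (suc m)) →
  vsum F ≡ vsum (λ y → sum (map (λ a → F (insertAt y i a)) (allFin q)))
vsum-lines {q = q} F zero    = sym (vsum-sum (λ a y → F (a ∷ y)) (allFin q))
vsum-lines {suc m} {q} F (suc i) = cong sum (map-cong (λ b → vsum-lines (λ y → F (b ∷ y)) i) (allFin q))

nonzero : ℤ → ℕ
nonzero z with z ℤ.≟ 0ℤ
... | yes _ = 0
... | no  _ = 1

nonzero-≢0 : ∀ {z} → z ≢ 0ℤ → nonzero z ≡ 1
nonzero-≢0 {z} z≢0 with z ℤ.≟ 0ℤ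
... | yes z≡0 = ⊥-elim (z≢0 z≡0)
... | no  _   = refl

nonzero≤1 : ∀ z → nonzero z ≤ 1
nonzero≤1 z with z ℤ.≟ 0ℤ
... | yes _ = z≤n
... | no  _ = ℕP.≤-refl

nonzero-difference : ∀ a b → nonzero (a -ᶻ b) ≤ nonzero b + nonzero a
nonzero-difference a b = cases (a ℤ.≟ 0ℤ) (b ℤ.≟ 0ℤ)
  where
  cases : Dec (a ≡ 0ℤ) → Dec (b ≡ 0ℤ) → nonzero (a -ᶻ b) ≤ nonzero b + nonzero a
  cases (yes refl) (yes refl) = z≤n
  cases (no a≢0)   _          =
    ℕP.≤-trans (nonzero≤1 _) (ℕP.≤-trans (ℕP.≤-reflexive (sym (nonzero-≢0 a≢0))) (ℕP.m≤n+m _ _))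
  cases (yes _)    (no b≢0)   =
    ℕP.≤-trans (nonzero≤1 _) (ℕP.≤-trans (ℕP.≤-reflexive (sym (nonzero-≢0 b≢0))) (ℕP.m≤m+n _ _))

support : ∀ {m q} → (Vertex m q → ℤ) → ℕ
support h = vsum (nonzero ∘ h)

searchVertex : ∀ {m q} (P : Vertex m q → Set) → (∀ x → Dec (P x)) → Dec (∃ P)
searchVertex {zero} P P? with P? []
... | yes p  = yes ([] , p)
... | no ¬p  = no λ { ([] , p) → ¬p p }
searchVertex {suc m} P P? with any? (λ a → searchVertex (λ y → P (a ∷ y)) (λ y → P? (a ∷ y)))
... | yes (a , y , p) = yes (a ∷ y , p)
... | no ¬p           = no λ { (a ∷ y , p) → ¬p (a , y , p) }

support-constant : ∀ {m q} (h : Vertex (suc m) q → ℤ) (a₀ : Fin q) →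
  (∀ a y → h (a ∷ y) ≡ h (a₀ ∷ y)) → support h ≡ q * support (slice h zero a₀)
support-constant {q = q} h a₀ constant = begin
  sum (map (λ a → support (slice h zero a)) (allFin q))  ≡⟨ cong sum (map-cong (λ a → vsum-cong (λ y → cong nonzero (constant a y))) (allFin q)) ⟩
  sum (map (λ _ → support (slice h zero a₀)) (allFin q)) ≡⟨ sum-map-const _ (allFin q) ⟩
  length (allFin q) * support (slice h zero a₀)           ≡⟨ cong (_* support (slice h zero a₀)) (length-tabulate {n = q} id) ⟩
  q * support (slice h zero a₀)                           ∎
  where open ≡-Reasoning

support-difference : ∀ {m q} (h : Vertex (suc m) q → ℤ) {a₁ a₀ : Fin q} → a₁ ≢ a₀ →
  support (λ y → slice h zero a₁ y -ᶻ slice h zero a₀ y) ≤ support h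
support-difference {q = q} h {a₁} {a₀} a₁≢a₀ = begin
  support (λ y → slice h zero a₁ y -ᶻ slice h zero a₀ y)
    ≤⟨ vsum-mono (λ y → nonzero-difference (slice h zero a₁ y) (slice h zero a₀ y)) ⟩
  vsum (λ y → nonzero (slice h zero a₀ y) + nonzero (slice h zero a₁ y))
    ≡⟨ vsum-+ (nonzero ∘ slice h zero a₀) (nonzero ∘ slice h zero a₁) ⟩
  support (slice h zero a₀) + support (slice h zero a₁)
    ≤⟨ sum-allFin-pair (λ a → support (slice h zero a)) a₁≢a₀ ⟩
  support h ∎
  where open ℕP.≤-Reasoning

raise-multiple : ∀ q t j → t -ᶻ + q ≡ + (q * j) → t ≡ + (q * suc j)
raise-multiple q t j t-q≡qj = begin
  t                      ≡⟨ add-back t (+ q) ⟩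
  (t -ᶻ + q) +ᶻ + q      ≡⟨ cong (_+ᶻ + q) t-q≡qj ⟩
  + (q * j) +ᶻ + q       ≡⟨ ℤP.pos-+ (q * j) q ⟨
  + (q * j + q)          ≡⟨ cong +_ (trans (ℕP.+-comm (q * j) q) (sym (ℕP.*-suc q j))) ⟩
  + (q * suc j)          ∎
  where
  open ≡-Reasoning
  add-back : ∀ t q → t ≡ (t -ᶻ q) +ᶻ q
  add-back = solve-∀

-- The conclusion of the support bound: t = qj and h is nonzero on at least q^(m-j) vertices.
SupportBound : ∀ {q} m → ℤ → (Vertex m q → ℤ) → Set
SupportBound {q} m t h = Σ ℕ λ j → t ≡ + (q * j) × q ^ m ≤ support h * q ^ j

support-step-constant : ∀ {m q} t (h : Vertex (suc m) q → ℤ) (a₀ : Fin q) →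
  (∀ a y → h (a ∷ y) ≡ h (a₀ ∷ y)) → SupportBound m t (slice h zero a₀) → SupportBound (suc m) t h
support-step-constant {m} {q} t h a₀ constant (j , t≡qj , bound) = j , t≡qj , (begin
  q * q ^ m                            ≤⟨ ℕP.*-monoʳ-≤ q bound ⟩
  q * (support (slice h zero a₀) * q ^ j) ≡⟨ ℕP.*-assoc q _ (q ^ j) ⟨
  q * support (slice h zero a₀) * q ^ j   ≡⟨ cong (_* q ^ j) (support-constant h a₀ constant) ⟨
  support h * q ^ j                    ∎)
  where open ℕP.≤-Reasoning

support-step-difference : ∀ {m q} t (h : Vertex (suc m) q → ℤ) {a₁ a₀ : Fin q} → a₁ ≢ a₀ →
  SupportBound m (t -ᶻ + q) (λ y → slice h zero a₁ y -ᶻ slice h zero a₀ y) → SupportBound (suc m) t h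
support-step-difference {m} {q} t h {a₁} {a₀} a₁≢a₀ (j , t-q≡qj , bound) =
  suc j , raise-multiple q t j t-q≡qj , (begin
  q * q ^ m              ≤⟨ ℕP.*-monoʳ-≤ q bound ⟩
  q * (Sd * q ^ j)       ≡⟨ *-exchange q Sd (q ^ j) ⟩
  Sd * (q * q ^ j)       ≤⟨ ℕP.*-monoˡ-≤ (q ^ suc j) (support-difference h a₁≢a₀) ⟩
  support h * q ^ suc j  ∎)
  where
  open ℕP.≤-Reasoning
  Sd : ℕ
  Sd = support (λ y → slice h zero a₁ y -ᶻ slice h zero a₀ y)

-- By induction on m:
-- either h ignores its first coordinate and we restrict to a slice, or two slices
-- differ and their difference is an eigenfunction of H(m-1,q) with t lowered by q.
support-bound : ∀ {q} m t (h : Vertex m q → ℤ) → IsEigen m t h → ∀ x → h x ≢ 0ℤ → SupportBound m t h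
support-bound {q} zero t h eig [] h≢0 = 0 , t≡0 , 1≤support
  where
  t*h≡0 : t *ᶻ h [] ≡ 0ℤ
  t*h≡0 = trans (sym (ℤP.+-identityˡ _)) (trans (eig []) (ℤP.*-zeroˡ (h [])))
  t≡0 : t ≡ + (q * 0)
  t≡0 with ℤP.i*j≡0⇒i≡0∨j≡0 t t*h≡0
  ... | inj₁ t≡0 = trans t≡0 (cong +_ (sym (ℕP.*-zeroʳ q)))
  ... | inj₂ h≡0 = ⊥-elim (h≢0 h≡0)
  1≤support : 1 ≤ support h * 1
  1≤support = ℕP.≤-reflexive (sym (trans (ℕP.*-identityʳ _) (nonzero-≢0 h≢0)))
support-bound {q} (suc m) t h eig (a₀ ∷ y₀) h≢0
  with searchVertex (λ x → h x ≢ h (a₀ ∷ tail x)) (λ x → ¬? (h x ℤ.≟ h (a₀ ∷ tail x)))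
... | yes (a₁ ∷ y₁ , slices-differ) =
  support-step-difference t h (λ a₁≡a₀ → slices-differ (cong (λ a → h (a ∷ y₁)) a₁≡a₀))
    (support-bound m (t -ᶻ + q) _ (difference-eigen t h eig zero a₁ a₀) y₁
      (λ d≡0 → slices-differ (ℤP.i-j≡0⇒i≡j _ _ d≡0)))
... | no slices-agree =
  support-step-constant t h a₀ constant
    (support-bound m t (slice h zero a₀) (constant-slice-eigen t h eig zero a₀ (λ y a → constant a y)) y₀ h≢0)
  where
  constant : ∀ a y → h (a ∷ y) ≡ h (a₀ ∷ y)
  constant a y with h (a ∷ y) ℤ.≟ h (a₀ ∷ y)
  ... | yes agree  = agree
  ... | no  differ = ⊥-elim (slices-agree (a ∷ y , differ))

count : ∀ {X : Set} → (X → Color) → Color → List X → ℕ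
count f k l = length (filter (λ y → f y ≟ k) l)

count-++ : ∀ {X : Set} (f : X → Color) k l l′ → count f k (l ++ l′) ≡ count f k l + count f k l′
count-++ f k l l′ = trans (cong length (filter-++ (λ y → f y ≟ k) l l′)) (length-++ (filter (λ y → f y ≟ k) l))

count-↭ : ∀ {X : Set} (f : X → Color) k {l l′ : List X} → l ↭ l′ → count f k l ≡ count f k l′
count-↭ f k l↭l′ = ↭-length (filter-↭ (λ y → f y ≟ k) l↭l′)

count-map : ∀ {X Y : Set} (f : Y → Color) k (g : X → Y) l → count f k (map g l) ≡ count (f ∘ g) k l
count-map f k g [] = refl
count-map f k g (x ∷ l) with f (g x) ≟ k
... | yes _ = cong suc (count-map f k g l)
... | no  _ = count-map f k g l

count-cong : ∀ {X : Set} {f g : X → Color} → (∀ y → f y ≡ g y) → ∀ k l → count f k l ≡ count g k l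
count-cong f≡g k [] = refl
count-cong {f = f} {g} f≡g k (x ∷ l) rewrite f≡g x with g x ≟ k
... | yes _ = cong suc (count-cong f≡g k l)
... | no  _ = count-cong f≡g k l

count-absent : ∀ {X : Set} (f : X → Color) k → (∀ y → f y ≢ k) → ∀ l → count f k l ≡ 0
count-absent f k absent [] = refl
count-absent f k absent (x ∷ l) with f x ≟ k
... | yes fx≡k = ⊥-elim (absent x fx≡k)
... | no  _    = count-absent f k absent l

count-concatMap : ∀ {X Y : Set} (f : Y → Color) k (G : X → List Y) l →
  count f k (concatMap G l) ≡ sum (map (count f k ∘ G) l)
count-concatMap f k G []      = refl
count-concatMap f k G (x ∷ l) = trans (count-++ f k (G x) (concatMap G l)) (cong (_+_ (count f k (G x))) (count-concatMap f k G l))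

count-both : ∀ {X : Set} (f : X → Color) l → count f zero l + count f (suc zero) l ≡ length l
count-both f [] = refl
count-both f (x ∷ l) with f x
... | zero     = cong suc (count-both f l)
... | suc zero = trans (ℕP.+-suc _ _) (cong suc (count-both f l))

count-in-slice : ∀ {n q} (F : Vertex (suc n) q → Color) k (y : Vertex n q) (i : Fin (suc n)) (a : Fin q) →
  (∀ a′ → F (insertAt y i a′) ≡ F (insertAt y i a)) → F (insertAt y i a) ≢ k →
  nbrsOfColor F k (insertAt y i a) ≡ nbrsOfColor (λ z → F (insertAt z i a)) k y
count-in-slice F k y i a line≡ F≢k = begin
  count F k (neighbours (insertAt y i a))
    ≡⟨ count-↭ F k (neighbours-insertAt y i a) ⟩
  count F k (map (insertAt y i) (others a) ++ map (λ z → insertAt z i a) (neighbours y))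
    ≡⟨ count-++ F k (map (insertAt y i) (others a)) _ ⟩
  count F k (map (insertAt y i) (others a)) + count F k (map (λ z → insertAt z i a) (neighbours y))
    ≡⟨ cong₂ _+_ (trans (count-map F k (insertAt y i) (others a)) lineAbsent) (count-map F k _ (neighbours y)) ⟩
  nbrsOfColor (λ z → F (insertAt z i a)) k y ∎
  where
  open ≡-Reasoning
  lineAbsent : count (F ∘ insertAt y i) k (others a) ≡ 0
  lineAbsent = count-absent (F ∘ insertAt y i) k (λ a′ F≡k → F≢k (trans (sym (line≡ a′)) F≡k)) (others a)

zero≢one : _≢_ {A = Color} zero (suc zero)
zero≢one ()

slice-colouring : ∀ {n q b c} (f : Vertex (suc n) q → Color) (i : Fin (suc n)) (a : Fin q) →
  (∀ y a′ → f (insertAt y i a′) ≡ f (insertAt y i a)) →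
  IsBCColoring (suc n) q b c f → IsBCColoring n q b c (λ z → f (insertAt z i a))
slice-colouring f i a ignores (onto , col₁ , col₂) = onto′ , col₁′ , col₂′
  where
  onto′ : ∀ k → ∃ λ y → f (insertAt y i a) ≡ k
  onto′ k with onto k
  ... | x , fx≡k = removeAt x i , (begin
    f (insertAt (removeAt x i) i a)            ≡⟨ ignores (removeAt x i) (lookup x i) ⟨
    f (insertAt (removeAt x i) i (lookup x i)) ≡⟨ cong f (insertAt-removeAt x i) ⟩
    f x                                        ≡⟨ fx≡k ⟩
    k                                          ∎)
    where open ≡-Reasoning
  col₁′ : ∀ y → f (insertAt y i a) ≡ zero → _
  col₁′ y fy≡0 = trans (sym (count-in-slice f (suc zero) y i a (ignores y) (λ fy≡1 → zero≢one (trans (sym fy≡0) fy≡1))))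
                       (col₁ (insertAt y i a) fy≡0)
  col₂′ : ∀ y → f (insertAt y i a) ≡ suc zero → _
  col₂′ y fy≡1 = trans (sym (count-in-slice f zero y i a (ignores y) (λ fy≡0 → zero≢one (trans (sym fy≡0) fy≡1))))
                       (col₂ (insertAt y i a) fy≡1)

extend-colouring : ∀ {n q b c} → HasBCColoring n (suc q) b c → HasBCColoring (suc n) (suc q) b c
extend-colouring {n} {q} {b} {c} (f , onto , col₁ , col₂) = f ∘ tail , onto′ , col₁′ , col₂′
  where
  onto′ : ∀ k → ∃ λ x → f (tail x) ≡ k
  onto′ k = zero ∷ proj₁ (onto k) , proj₂ (onto k)
  col₁′ : ∀ x → f (tail x) ≡ zero → nbrsOfColor (f ∘ tail) (suc zero) x ≡ b
  col₁′ (a ∷ y) fy≡0 = trans (count-in-slice (f ∘ tail) (suc zero) y zero a (λ _ → refl) (λ fy≡1 → zero≢one (trans (sym fy≡0) fy≡1))) (col₁ y fy≡0)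
  col₂′ : ∀ x → f (tail x) ≡ suc zero → nbrsOfColor (f ∘ tail) zero x ≡ c
  col₂′ (a ∷ y) fy≡1 = trans (count-in-slice (f ∘ tail) zero y zero a (λ _ → refl) (λ fy≡0 → zero≢one (trans (sym fy≡0) fy≡1))) (col₂ y fy≡1)

-- The weights turning a (b,c)-colouring into an eigenfunction: b on colour 1, -c on colour 2.
weight : ℕ → ℕ → Color → ℤ
weight b c zero       = + b
weight b c (suc zero) = ℤ.- (+ c)

weight-injective : ∀ {b c} → c ≥ 1 → ∀ k₁ k₀ → weight b c k₁ ≡ weight b c k₀ → k₁ ≡ k₀
weight-injective _       zero       zero       _ = refl
weight-injective _       (suc zero) (suc zero) _ = refl
weight-injective {c = suc c} _ zero       (suc zero) ()
weight-injective {c = suc c} _ (suc zero) zero       ()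

sumℤ-weights : ∀ {X : Set} b c (f : X → Color) l →
  sumℤ (map (weight b c ∘ f) l) ≡ + b *ᶻ + count f zero l -ᶻ + c *ᶻ + count f (suc zero) l
sumℤ-weights b c f [] = none (+ b) (+ c)
  where none : ∀ β γ → 0ℤ ≡ β *ᶻ 0ℤ -ᶻ γ *ᶻ 0ℤ
        none = solve-∀
sumℤ-weights b c f (x ∷ l) with f x
... | zero     = trans (cong (+ b +ᶻ_) (sumℤ-weights b c f l)) (one-more (+ b) (+ c) (+ count f zero l) _)
  where one-more : ∀ β γ n₀ n₁ → β +ᶻ (β *ᶻ n₀ -ᶻ γ *ᶻ n₁) ≡ β *ᶻ (1ℤ +ᶻ n₀) -ᶻ γ *ᶻ n₁
        one-more = solve-∀
... | suc zero = trans (cong (ℤ.- (+ c) +ᶻ_) (sumℤ-weights b c f l)) (one-more (+ b) (+ c) _ (+ count f (suc zero) l))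
  where one-more : ∀ β γ n₀ n₁ → ℤ.- γ +ᶻ (β *ᶻ n₀ -ᶻ γ *ᶻ n₁) ≡ β *ᶻ n₀ -ᶻ γ *ᶻ (1ℤ +ᶻ n₁)
        one-more = solve-∀

weight-balance : ∀ b c k N₀ N₁ → (k ≡ zero → N₁ ≡ b) → (k ≡ suc zero → N₀ ≡ c) →
  (+ b *ᶻ + N₀ -ᶻ + c *ᶻ + N₁) +ᶻ + (b + c) *ᶻ weight b c k ≡ + (N₀ + N₁) *ᶻ weight b c k
weight-balance b c zero N₀ N₁ N₁≡b _
  rewrite N₁≡b refl | ℤP.pos-+ b c | ℤP.pos-+ N₀ b = balance (+ b) (+ c) (+ N₀)
  where balance : ∀ β γ n₀ → (β *ᶻ n₀ -ᶻ γ *ᶻ β) +ᶻ (β +ᶻ γ) *ᶻ β ≡ (n₀ +ᶻ β) *ᶻ β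
        balance = solve-∀
weight-balance b c (suc zero) N₀ N₁ _ N₀≡c
  rewrite N₀≡c refl | ℤP.pos-+ b c | ℤP.pos-+ c N₁ = balance (+ b) (+ c) (+ N₁)
  where balance : ∀ β γ n₁ → (β *ᶻ γ -ᶻ γ *ᶻ n₁) +ᶻ (β +ᶻ γ) *ᶻ ℤ.- γ ≡ (γ +ᶻ n₁) *ᶻ ℤ.- γ
        balance = solve-∀

colouring-eigen : ∀ {n q b c} (f : Vertex n q → Color) → IsBCColoring n q b c f →
  IsEigen n (+ (b + c)) (weight b c ∘ f)
colouring-eigen {n} {q} {b} {c} f (_ , col₁ , col₂) x = begin
  A (weight b c ∘ f) x +ᶻ + (b + c) *ᶻ weight b c (f x)
    ≡⟨ cong (_+ᶻ + (b + c) *ᶻ weight b c (f x)) (sumℤ-weights b c f (neighbours x)) ⟩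
  (+ b *ᶻ + N₀ -ᶻ + c *ᶻ + N₁) +ᶻ + (b + c) *ᶻ weight b c (f x)
    ≡⟨ weight-balance b c (f x) N₀ N₁ (col₁ x) (col₂ x) ⟩
  + (N₀ + N₁) *ᶻ weight b c (f x)
    ≡⟨ cong (λ d → + d *ᶻ weight b c (f x)) (trans (count-both f (neighbours x)) (length-neighbours x)) ⟩
  degree q n *ᶻ weight b c (f x) ∎
  where
  open ≡-Reasoning
  N₀ N₁ : ℕ
  N₀ = nbrsOfColor f zero x
  N₁ = nbrsOfColor f (suc zero) x

other : Color → Color
other zero       = suc zero
other (suc zero) = zero

other-≢ : ∀ k₁ k₀ → k₁ ≢ k₀ → k₁ ≡ other k₀
other-≢ zero       zero       k₁≢k₀ = ⊥-elim (k₁≢k₀ refl)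
other-≢ zero       (suc zero) _     = refl
other-≢ (suc zero) zero       _     = refl
other-≢ (suc zero) (suc zero) k₁≢k₀ = ⊥-elim (k₁≢k₀ refl)

other-neighbours≤ : ∀ {n q b c} (f : Vertex n q → Color) → IsBCColoring n q b c f →
  ∀ x → nbrsOfColor f (other (f x)) x ≤ b + c
other-neighbours≤ {b = b} {c} f (_ , col₁ , col₂) x with f x in fx≡
... | zero     = ℕP.≤-trans (ℕP.≤-reflexive (col₁ x fx≡)) (ℕP.m≤m+n b c)
... | suc zero = ℕP.≤-trans (ℕP.≤-reflexive (col₂ x fx≡)) (ℕP.m≤n+m c b)

-- The bichromatic edges in direction i, counted from both endpoints.
bichromatic : ∀ {n q} → (Vertex n q → Color) → Fin n → ℕ
bichromatic f i = vsum (λ x → count f (other (f x)) (neighboursAlong x i))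

bichromatic-total : ∀ {n q b c} (f : Vertex n q → Color) → IsBCColoring n q b c f →
  sum (map (bichromatic f) (allFin n)) ≤ q ^ n * (b + c)
bichromatic-total {n} {q} {b} {c} f colouring = begin
  sum (map (bichromatic f) (allFin n))
    ≡⟨ vsum-sum (λ i x → count f (other (f x)) (neighboursAlong x i)) (allFin n) ⟨
  vsum (λ x → sum (map (count f (other (f x)) ∘ neighboursAlong x) (allFin n)))
    ≡⟨ vsum-cong (λ x → count-concatMap f (other (f x)) (neighboursAlong x) (allFin n)) ⟨
  vsum (λ x → nbrsOfColor f (other (f x)) x)
    ≤⟨ vsum-mono (other-neighbours≤ f colouring) ⟩
  vsum {n} {q} (λ _ → b + c)
    ≡⟨ vsum-const {n} (b + c) ⟩
  q ^ n * (b + c) ∎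
  where open ℕP.≤-Reasoning

Depends : ∀ {n q} → (Vertex (suc n) q → Color) → Fin (suc n) → Set
Depends {n} {q} f i = Σ (Vertex n q) λ y → Σ (Fin q) λ a₁ → Σ (Fin q) λ a₀ → f (insertAt y i a₁) ≢ f (insertAt y i a₀)

depends? : ∀ {n q} (f : Vertex (suc n) q → Color) i → Dec (Depends f i)
depends? f i with searchVertex _ (λ y → any? (λ a₁ → any? (λ a₀ → ¬? (f (insertAt y i a₁) ≟ f (insertAt y i a₀)))))
... | yes (y , a₁ , a₀ , differ) = yes (y , a₁ , a₀ , differ)
... | no none                    = no λ (y , a₁ , a₀ , differ) → none (y , a₁ , a₀ , differ)

ignores : ∀ {n q} (f : Vertex (suc n) q → Color) i → ¬ Depends f i → ∀ a y a′ → f (insertAt y i a′) ≡ f (insertAt y i a)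
ignores f i independent a y a′ with f (insertAt y i a′) ≟ f (insertAt y i a)
... | yes same   = same
... | no  differ = ⊥-elim (independent (y , a′ , a , differ))

symbol⇒NonZero : ∀ {q} → Fin q → NonZero q
symbol⇒NonZero {suc q} _ = _

below-multiple : ∀ {q} → Fin q → ∀ j → j ≤ q * suc j
below-multiple {suc q} _ j = ℕP.≤-trans (ℕP.n≤1+n j) (ℕP.m≤m+n (suc j) (q * suc j))

difference-≤-bichromatic : ∀ {n q} b c (f : Vertex (suc n) q → Color) i a₁ a₀ (y : Vertex n q) →
  nonzero (weight b c (f (insertAt y i a₁)) -ᶻ weight b c (f (insertAt y i a₀)))
    ≤ count f (other (f (insertAt y i a₀))) (neighboursAlong (insertAt y i a₀) i)
difference-≤-bichromatic b c f i a₁ a₀ y with f (insertAt y i a₁) ≟ f (insertAt y i a₀)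
... | yes same = ℕP.≤-trans (ℕP.≤-reflexive (cong nonzero vanishes)) z≤n
  where
  w₀ : ℤ
  w₀ = weight b c (f (insertAt y i a₀))
  vanishes : weight b c (f (insertAt y i a₁)) -ᶻ w₀ ≡ 0ℤ
  vanishes = trans (cong (λ k → weight b c k -ᶻ w₀) same) (ℤP.+-inverseʳ w₀)
... | no differ = ℕP.≤-trans (nonzero≤1 _) (filter-some (λ z → f z ≟ k) otherColoured)
  where
  k : Color
  k = other (f (insertAt y i a₀))
  a₁≢a₀ : a₁ ≢ a₀
  a₁≢a₀ a₁≡a₀ = differ (cong (λ a → f (insertAt y i a)) a₁≡a₀)
  otherColoured : Any.Any (λ z → f z ≡ k) (neighboursAlong (insertAt y i a₀) i)
  otherColoured = Any.map (λ { refl → other-≢ _ _ differ }) (insertAt-∈-neighboursAlong y i a₁≢a₀)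

-- In a direction the colouring depends on there are at least q^(n-(b+c)) bichromatic
-- edge-ends: the difference of two weighted slices is a nonzero eigenfunction, so the
-- support bound applies, with j ≤ b + c because b + c = q(j+1).
essential-bichromatic : ∀ {n q b c} → c ≥ 1 → (f : Vertex (suc n) q → Color) → IsBCColoring (suc n) q b c f →
  ∀ i → Depends f i → q ^ n ≤ bichromatic f i * q ^ (b + c)
essential-bichromatic {n} {q} {b} {c} c≥1 f colouring i (y₁ , a₁ , a₀ , differ) =
  conclude (support-bound n (+ (b + c) -ᶻ + q) d
             (difference-eigen (+ (b + c)) (weight b c ∘ f) (colouring-eigen f colouring) i a₁ a₀) y₁ d≢0)
  where
  instance _ = symbol⇒NonZero a₀
  d : Vertex n q → ℤ
  d y = weight b c (f (insertAt y i a₁)) -ᶻ weight b c (f (insertAt y i a₀))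
  d≢0 : d y₁ ≢ 0ℤ
  d≢0 d≡0 = differ (weight-injective c≥1 _ _ (ℤP.i-j≡0⇒i≡j _ _ d≡0))
  G : Vertex (suc n) q → ℕ
  G x = count f (other (f x)) (neighboursAlong x i)
  support≤ : support d ≤ bichromatic f i
  support≤ = begin
    support d                                            ≤⟨ vsum-mono (difference-≤-bichromatic b c f i a₁ a₀) ⟩
    vsum (λ y → G (insertAt y i a₀))                     ≤⟨ vsum-mono (λ y → sum-allFin-≥ (G ∘ insertAt y i) a₀) ⟩
    vsum (λ y → sum (map (G ∘ insertAt y i) (allFin q))) ≡⟨ vsum-lines G i ⟨
    bichromatic f i                                      ∎
    where open ℕP.≤-Reasoning
  conclude : SupportBound n (+ (b + c) -ᶻ + q) d → q ^ n ≤ bichromatic f i * q ^ (b + c)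
  conclude (j , t≡qj , bound) = begin
    q ^ n                           ≤⟨ bound ⟩
    support d * q ^ j               ≤⟨ ℕP.*-mono-≤ support≤ (ℕP.^-monoʳ-≤ q j≤b+c) ⟩
    bichromatic f i * q ^ (b + c)   ∎
    where
    open ℕP.≤-Reasoning
    j≤b+c : j ≤ b + c
    j≤b+c = subst (j ≤_) (sym (ℤP.+-injective (raise-multiple q (+ (b + c)) j t≡qj))) (below-multiple a₀ j)

-- Comparing the lower bound in each direction with the total: a (b,c)-colouring of
-- H(n+1,q) that depends on every coordinate has n + 1 ≤ q (b+c) q^(b+c).
all-essential-bound : ∀ {n q b c} → c ≥ 1 → (f : Vertex (suc n) q → Color) → IsBCColoring (suc n) q b c f →
  (∀ i → Depends f i) → suc n ≤ q * (b + c) * q ^ (b + c)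
all-essential-bound {n} {q} {b} {c} c≥1 f colouring essential = ℕP.*-cancelˡ-≤ (q ^ n) (begin
  q ^ n * suc n
    ≡⟨ ℕP.*-comm (q ^ n) (suc n) ⟩
  suc n * q ^ n
    ≡⟨ cong (_* q ^ n) (length-tabulate {n = suc n} id) ⟨
  length (allFin (suc n)) * q ^ n
    ≡⟨ sum-map-const (q ^ n) (allFin (suc n)) ⟨
  sum (map (λ _ → q ^ n) (allFin (suc n)))
    ≤⟨ sum-map-mono (λ i → essential-bichromatic c≥1 f colouring i (essential i)) (allFin (suc n)) ⟩
  sum (map (λ i → bichromatic f i * q ^ (b + c)) (allFin (suc n)))
    ≡⟨ sum-map-*ʳ (bichromatic f) (q ^ (b + c)) (allFin (suc n)) ⟩
  sum (map (bichromatic f) (allFin (suc n))) * q ^ (b + c)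
    ≤⟨ ℕP.*-monoˡ-≤ (q ^ (b + c)) (bichromatic-total f colouring) ⟩
  q * q ^ n * (b + c) * q ^ (b + c)
    ≡⟨ rearrange q (q ^ n) (b + c) (q ^ (b + c)) ⟩
  q ^ n * (q * (b + c) * q ^ (b + c)) ∎)
  where
  open ℕP.≤-Reasoning
  instance
    q≢0 : NonZero q
    q≢0 = symbol⇒NonZero (proj₁ (proj₂ (essential zero)))
    qⁿ≢0 : NonZero (q ^ n)
    qⁿ≢0 = ℕP.m^n≢0 q n
  rearrange : ∀ q Q s r → q * Q * s * r ≡ Q * (q * s * r)
  rearrange = ℕSolver.solve-∀

-- Dropping coordinates a colouring ignores: if H(n,q) is (b,c)-colourable, so is
-- H(m,q) for some m ≤ q (b+c) q^(b+c).
colourable-within : ∀ {q b c} → c ≥ 1 → ∀ n → HasBCColoring n q b c →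
  Σ ℕ λ m → m ≤ q * (b + c) * q ^ (b + c) × HasBCColoring m q b c
colourable-within c≥1 zero    colourable = zero , z≤n , colourable
colourable-within {q} c≥1 (suc n) (f , colouring) with any? (λ i → ¬? (depends? f i))
... | yes (i , independent) =
  colourable-within c≥1 n (_ , slice-colouring f i a (λ y a′ → ignores f i independent a y a′) colouring)
  where
  -- any symbol will do, e.g. the first coordinate of some vertex
  a : Fin q
  a = head (proj₁ (proj₁ colouring zero))
... | no  allDepend = suc n , all-essential-bound c≥1 f colouring essential , f , colouring
  where
  essential : ∀ i → Depends f i
  essential i with depends? f i
  ... | yes depends = depends
  ... | no  ¬depends = ⊥-elim (allDepend (i , ¬depends))

Searchable : (X : Set) → (X → X → Set) → Set₁
Searchable X _≈_ = ∀ (P : X → Set) → (∀ {x y} → x ≈ y → P x → P y) → (∀ x → Dec (P x)) → Dec (Σ X P)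

-- Finite tuples Fin k → X of a searchable X are searchable, pointwise: search for the
-- first entry such that some tuple of the remaining entries completes it.
searchable-tuples : ∀ {X : Set} (R : X → X → Set) → (∀ x → R x x) → Searchable X R →
  ∀ k → Searchable (Fin k → X) (λ g h → ∀ a → R (g a) (h a))
searchable-tuples R R-refl search zero P invariant P? with P? (λ ())
... | yes p  = yes ((λ ()) , p)
... | no ¬p  = no λ (g , p) → ¬p (invariant (λ ()) p)
searchable-tuples {X} R R-refl search (suc k) P invariant P? with search Completable completable-invariant completable?
  where
  cons : X → (Fin k → X) → Fin (suc k) → X
  cons x g zero    = x
  cons x g (suc a) = g a
  Completable : X → Set
  Completable x = Σ (Fin k → X) λ g → P (cons x g)
  completable-invariant : ∀ {x y} → R x y → Completable x → Completable y
  completable-invariant {x} {y} x≈y (g , p) = g , invariant (λ { zero → x≈y ; (suc a) → R-refl (g a) }) p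
  completable? : ∀ x → Dec (Completable x)
  completable? x = searchable-tuples R R-refl search k (λ g → P (cons x g))
    (λ g≈h p → invariant (λ { zero → R-refl x ; (suc a) → g≈h a }) p) (λ g → P? (cons x g))
... | yes (x , g , p) = yes (_ , p)
... | no ¬p = no λ (h , p) → ¬p (h zero , (λ a → h (suc a)) ,
                   invariant (λ { zero → R-refl (h zero) ; (suc a) → R-refl (h (suc a)) }) p)

-- Functions from the vertices of H(n,q) to a finite set are searchable, pointwise:
-- such a function is a q-tuple of functions on H(n-1,q).
searchable-functions : ∀ {q k} n → Searchable (Vertex n q → Fin k) (λ f g → ∀ x → f x ≡ g x)
searchable-functions zero P invariant P? with any? (λ k → P? (λ _ → k))
... | yes (k , p) = yes (_ , p)
... | no ¬p       = no λ (f , p) → ¬p (f [] , invariant (λ { [] → refl }) p)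
searchable-functions {q} (suc n) P invariant P?
  with searchable-tuples _ (λ f x → refl) (searchable-functions n) q
         (λ g → P (uncurry g)) (λ g≈h p → invariant (λ { (a ∷ y) → g≈h a y }) p) (λ g → P? (uncurry g))
  where
  uncurry : (Fin q → Vertex n q → Fin _) → Vertex (suc n) q → Fin _
  uncurry g (a ∷ y) = g a y
... | yes (g , p) = yes (_ , p)
... | no ¬p       = no λ (f , p) → ¬p ((λ a y → f (a ∷ y)) , invariant (λ { (a ∷ y) → refl }) p)

allVertices? : ∀ {n q} (P : Vertex n q → Set) → (∀ x → Dec (P x)) → Dec (∀ x → P x)
allVertices? P P? with searchVertex (λ x → ¬ P x) (λ x → ¬? (P? x))
... | yes (x , ¬p) = no λ all → ¬p (all x)
... | no none      = yes λ x → holds x (P? x)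
  where
  holds : ∀ x → Dec (P x) → P x
  holds x (yes p) = p
  holds x (no ¬p) = ⊥-elim (none (x , ¬p))

isColouring? : ∀ n q b c (f : Vertex n q → Color) → Dec (IsBCColoring n q b c f)
isColouring? n q b c f =
  all? (λ k → searchVertex (λ x → f x ≡ k) (λ x → f x ≟ k))
  ×-dec allVertices? _ (λ x → (f x ≟ zero) →-dec (nbrsOfColor f (suc zero) x ℕP.≟ b))
  ×-dec allVertices? _ (λ x → (f x ≟ suc zero) →-dec (nbrsOfColor f zero x ℕP.≟ c))

isColouring-resp : ∀ {n q b c} {f g : Vertex n q → Color} → (∀ x → f x ≡ g x) →
  IsBCColoring n q b c f → IsBCColoring n q b c g
isColouring-resp f≡g (onto , col₁ , col₂) =
  (λ k → proj₁ (onto k) , trans (sym (f≡g (proj₁ (onto k)))) (proj₂ (onto k))) ,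
  (λ x gx≡0 → trans (sym (count-cong f≡g (suc zero) (neighbours x))) (col₁ x (trans (f≡g x) gx≡0))) ,
  (λ x gx≡1 → trans (sym (count-cong f≡g zero (neighbours x))) (col₂ x (trans (f≡g x) gx≡1)))

hasColouring? : ∀ n q b c → Dec (HasBCColoring n q b c)
hasColouring? n q b c = searchable-functions n (IsBCColoring n q b c) isColouring-resp (isColouring? n q b c)

-- H(0,q) has a single vertex, so it cannot be coloured onto both colours.
H0-uncolourable : ∀ {q b c} → ¬ HasBCColoring 0 q b c
H0-uncolourable (f , onto , _) with onto zero | onto (suc zero)
... | [] , f[]≡0 | [] , f[]≡1 = zero≢one (trans (sym f[]≡0) f[]≡1)

least-below : ∀ {P : ℕ → Set} → (∀ n → Dec (P n)) → ∀ N →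
  (∀ n → n ≤ N → ¬ P n) ⊎ Σ ℕ λ n₀ → P n₀ × (∀ n → n < n₀ → ¬ P n)
least-below P? zero with P? zero
... | yes p  = inj₂ (zero , p , λ _ ())
... | no ¬p  = inj₁ λ { zero z≤n → ¬p }
least-below P? (suc N) with least-below P? N
... | inj₂ least = inj₂ least
... | inj₁ none with P? (suc N)
...   | yes p  = inj₂ (suc N , p , λ n n<1+N → none n (ℕP.≤-pred n<1+N))
...   | no ¬p  = inj₁ below
  where
  below : ∀ n → n ≤ suc N → ¬ _
  below n n≤1+N with ℕP.m≤n⇒m<n∨m≡n n≤1+N
  ... | inj₁ n<1+N  = none n (ℕP.≤-pred n<1+N)
  ... | inj₂ refl   = ¬p

upward : ∀ {P : ℕ → Set} → (∀ n → P n → P (suc n)) → ∀ {m n} → m ≤ n → P m → P n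
upward step {n = zero}  z≤n  p = p
upward step {m} {suc n} m≤1+n p with ℕP.m≤n⇒m<n∨m≡n m≤1+n
... | inj₁ m<1+n = step n (upward step (ℕP.≤-pred m<1+n) p)
... | inj₂ refl  = p

threshold : (P : ℕ → Set) → (∀ n → Dec (P n)) → ¬ P 0 → (∀ n → P n → P (suc n)) →
  ∀ N → (∀ n → P n → Σ ℕ λ m → m ≤ N × P m) →
  ((n : ℕ) → n ≥ 1 → ¬ P n) ⊎ Σ ℕ (λ n₀ → n₀ ≥ 1 × ((n : ℕ) → n ≥ 1 → (P n ⇔ n₀ ≤ n)))
threshold P P? ¬P0 step N within with least-below P? N
... | inj₁ none = inj₁ λ n _ p → let (m , m≤N , pm) = within n p in none m m≤N pm
... | inj₂ (n₀ , pn₀ , minimal) = inj₂ (n₀ , positive n₀ pn₀ , λ n _ → mk⇔ (above n) (λ n₀≤n → upward step n₀≤n pn₀))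
  where
  positive : ∀ n → P n → n ≥ 1
  positive zero    p0 = ⊥-elim (¬P0 p0)
  positive (suc _) _  = s≤s z≤n
  above : ∀ n → P n → n₀ ≤ n
  above n pn with n₀ ℕP.≤? n
  ... | yes n₀≤n = n₀≤n
  ... | no  n₀≰n = ⊥-elim (minimal n (ℕP.≰⇒> n₀≰n) pn)

-- Colourability of H(n,q) is decidable, fails at n = 0, is inherited upwards and is
-- attained within q(b+c)q^(b+c) dimensions if at all, so `threshold` applies.
proposition10 : (q b c : ℕ) → q ≥ 2 → b ≥ 1 → c ≥ 1 →
    ((n : ℕ) → n ≥ 1 → ¬ HasBCColoring n q b c)
    ⊎ Σ ℕ (λ n₀ → n₀ ≥ 1 × ((n : ℕ) → n ≥ 1 → (HasBCColoring n q b c ⇔ n₀ ≤ n)))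
proposition10 zero    b c () _ _
proposition10 (suc q) b c _ _ c≥1 =
  threshold (λ n → HasBCColoring n (suc q) b c) (λ n → hasColouring? n (suc q) b c) H0-uncolourable
    (λ _ → extend-colouring) (suc q * (b + c) * suc q ^ (b + c)) (colourable-within c≥1)
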